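{- For every process $P$, the relation $\to_P$ is terminating: there is no infinite sequence $Q_0\to_P Q_1\to_P Q_2\to_P\cdots$.
   Context: Fix a countable set of actions. Finite processes: $F ::= 0 \mid \alpha.F \mid F|F$. Processes: $P ::= F \mid\ !\alpha.F \mid P|P$. Finite single-hole contexts: $D ::= [\,] \mid \alpha.D \mid D|F$; contexts: $C ::= D \mid\ !\alpha.D \mid C|P$. $\equiv_D$ is the smallest congruence containing the abelian monoid laws for $|$ with neutral $0$ and the distribution law $\alpha.(F|\alpha.F|\cdots|\alpha.F)=\alpha.F|\cdots|\alpha.F$ ($k\ge0$ copies of $\alpha.F$ on the left, $k+1$ on the right). Each process $T$ induces a relation $\to_T$, defined modulo $\equiv_D$ by (B1) $C[\alpha.F]\to_T C[0]$ whenever $T\equiv_D\ !\alpha.F|F'$ for some process $F'$, and (B2) $!\alpha.F|\,!\alpha.F|P\to_T\ !\alpha.F|P$. -}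

module Defs where

open import Data.Nat using (ℕ; zero; suc)
open import Data.Product using (Σ; ∃; _×_; _,_)

data FinP (A : Set) : Set where
  nil : FinP A
  pre : A → FinP A → FinP A
  _∣_ : FinP A → FinP A → FinP A

data Proc (A : Set) : Set where
  fin  : FinP A → Proc A
  bang : A → FinP A → Proc A
  _∥_  : Proc A → Proc A → Proc A

infixr 6 _∣_
infixr 5 _∥_

copies : {A : Set} → ℕ → FinP A → FinP A
copies zero    G = nil
copies (suc k) G = G ∣ copies k G

data _≈F_ {A : Set} : FinP A → FinP A → Set where
  reflF   : ∀ {F} → F ≈F F
  symF    : ∀ {F G} → F ≈F G → G ≈F F
  transF  : ∀ {F G H} → F ≈F G → G ≈F H → F ≈F H
  assocF  : ∀ {F G H} → ((F ∣ G) ∣ H) ≈F (F ∣ (G ∣ H))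
  commF   : ∀ {F G} → (F ∣ G) ≈F (G ∣ F)
  unitF   : ∀ {F} → (F ∣ nil) ≈F F
  distrF  : ∀ {a F} (k : ℕ) →
            pre a (F ∣ copies k (pre a F)) ≈F copies (suc k) (pre a F)
  preF    : ∀ {a F G} → F ≈F G → pre a F ≈F pre a G
  parF    : ∀ {F F' G G'} → F ≈F F' → G ≈F G' → (F ∣ G) ≈F (F' ∣ G')

-- ≡_D on processes.  A finite process F is embedded as `fin F`; the
-- rules finPar/finNil identify the two ways of reading F|G and 0 as processes.
data _≈_ {A : Set} : Proc A → Proc A → Set where
  refl≈   : ∀ {P} → P ≈ P
  sym≈    : ∀ {P Q} → P ≈ Q → Q ≈ P
  trans≈  : ∀ {P Q R} → P ≈ Q → Q ≈ R → P ≈ R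
  assoc≈  : ∀ {P Q R} → ((P ∥ Q) ∥ R) ≈ (P ∥ (Q ∥ R))
  comm≈   : ∀ {P Q} → (P ∥ Q) ≈ (Q ∥ P)
  unit≈   : ∀ {P} → (P ∥ fin nil) ≈ P
  finPar  : ∀ {F G} → fin (F ∣ G) ≈ (fin F ∥ fin G)
  fin≈    : ∀ {F G} → F ≈F G → fin F ≈ fin G
  bang≈   : ∀ {a F G} → F ≈F G → bang a F ≈ bang a G
  par≈    : ∀ {P P' Q Q'} → P ≈ P' → Q ≈ Q' → (P ∥ Q) ≈ (P' ∥ Q')

data FCtx (A : Set) : Set where
  hole  : FCtx A
  preD  : A → FCtx A → FCtx A
  parD  : FCtx A → FinP A → FCtx A

data Ctx (A : Set) : Set where
  finC  : FCtx A → Ctx A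
  bangC : A → FCtx A → Ctx A
  parC  : Ctx A → Proc A → Ctx A

fillD : {A : Set} → FCtx A → FinP A → FinP A
fillD hole       F = F
fillD (preD a D) F = pre a (fillD D F)
fillD (parD D G) F = fillD D F ∣ G

fillC : {A : Set} → Ctx A → FinP A → Proc A
fillC (finC D)    F = fin (fillD D F)
fillC (bangC a D) F = bang a (fillD D F)
fillC (parC C P)  F = fillC C F ∥ P

data Base {A : Set} (T : Proc A) : Proc A → Proc A → Set where
  B1 : ∀ (C : Ctx A) (a : A) (F : FinP A) (F' : Proc A) →
       T ≈ (bang a F ∥ F') →
       Base T (fillC C (pre a F)) (fillC C nil)
  B2 : ∀ (a : A) (F : FinP A) (P : Proc A) →
       Base T (bang a F ∥ (bang a F ∥ P)) (bang a F ∥ P)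

_⟶[_]_ : {A : Set} → Proc A → Proc A → Proc A → Set
Q ⟶[ T ] Q' = ∃ λ R → ∃ λ R' → (Q ≈ R) × Base T R R' × (R' ≈ Q')

-- Count the prefixes of a process, a replication !α.F counting as one.  Both
-- sides of the distribution law contain the same number of prefixes, so this
-- size is invariant under ≡_D, while (B1) deletes a prefix and (B2) deletes a
-- replication.  Hence every step strictly decreases the size.
module Submission where

open import Defs
open import Data.Nat using (ℕ; suc; _+_; _<_; s≤s; z≤n)
open import Data.Nat.Induction using (<-wellFounded)
open import Data.Nat.Properties using (+-assoc; +-comm; +-identityʳ; +-monoˡ-<)
open import Data.Product using (Σ; _,_)
open import Data.Empty using (⊥)
open import Function using (_∘_)
open import Function.Bundles using (_↣_)
open import Induction.WellFounded using (WellFounded; Acc; acc)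
open import Relation.Binary.Construct.On as On using ()
open import Relation.Binary.PropositionalEquality using (_≡_; refl; sym; trans; cong; cong₂; subst₂)
open import Relation.Nullary using (¬_)

wellFounded⇒¬descendingChain : {B : Set} {_≺_ : B → B → Set} → WellFounded _≺_ →
                               ¬ (Σ (ℕ → B) λ x → (n : ℕ) → x (suc n) ≺ x n)
wellFounded⇒¬descendingChain {B} {_≺_} wf (x , desc) = noChainFrom x (wf (x 0)) desc
  where
  noChainFrom : (y : ℕ → B) → Acc _≺_ (y 0) → ((n : ℕ) → y (suc n) ≺ y n) → ⊥
  noChainFrom y (acc rs) d = noChainFrom (y ∘ suc) (rs (d 0)) (d ∘ suc)

sizeF : {A : Set} → FinP A → ℕ
sizeF nil       = 0
sizeF (pre a F) = suc (sizeF F)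
sizeF (F ∣ G)   = sizeF F + sizeF G

size : {A : Set} → Proc A → ℕ
size (fin F)    = sizeF F
size (bang a F) = suc (sizeF F)
size (P ∥ Q)    = size P + size Q

sizeF-resp-≈F : {A : Set} {F G : FinP A} → F ≈F G → sizeF F ≡ sizeF G
sizeF-resp-≈F reflF                 = refl
sizeF-resp-≈F (symF p)              = sym (sizeF-resp-≈F p)
sizeF-resp-≈F (transF p q)          = trans (sizeF-resp-≈F p) (sizeF-resp-≈F q)
sizeF-resp-≈F (assocF {F} {G} {H})  = +-assoc (sizeF F) (sizeF G) (sizeF H)
sizeF-resp-≈F (commF {F} {G})       = +-comm (sizeF F) (sizeF G)
sizeF-resp-≈F (unitF {F})           = +-identityʳ (sizeF F)
sizeF-resp-≈F (distrF k)            = refl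
sizeF-resp-≈F (preF p)              = cong suc (sizeF-resp-≈F p)
sizeF-resp-≈F (parF p q)            = cong₂ _+_ (sizeF-resp-≈F p) (sizeF-resp-≈F q)

size-resp-≈ : {A : Set} {P Q : Proc A} → P ≈ Q → size P ≡ size Q
size-resp-≈ refl≈                 = refl
size-resp-≈ (sym≈ p)              = sym (size-resp-≈ p)
size-resp-≈ (trans≈ p q)          = trans (size-resp-≈ p) (size-resp-≈ q)
size-resp-≈ (assoc≈ {P} {Q} {R})  = +-assoc (size P) (size Q) (size R)
size-resp-≈ (comm≈ {P} {Q})       = +-comm (size P) (size Q)
size-resp-≈ (unit≈ {P})           = +-identityʳ (size P)
size-resp-≈ finPar                = refl
size-resp-≈ (fin≈ p)              = sizeF-resp-≈F p
size-resp-≈ (bang≈ p)             = cong suc (sizeF-resp-≈F p)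
size-resp-≈ (par≈ p q)            = cong₂ _+_ (size-resp-≈ p) (size-resp-≈ q)

fillD-mono-< : {A : Set} (D : FCtx A) {F G : FinP A} →
               sizeF F < sizeF G → sizeF (fillD D F) < sizeF (fillD D G)
fillD-mono-< hole       lt = lt
fillD-mono-< (preD a D) lt = s≤s (fillD-mono-< D lt)
fillD-mono-< (parD D H) lt = +-monoˡ-< (sizeF H) (fillD-mono-< D lt)

fillC-mono-< : {A : Set} (C : Ctx A) {F G : FinP A} →
               sizeF F < sizeF G → size (fillC C F) < size (fillC C G)
fillC-mono-< (finC D)    lt = fillD-mono-< D lt
fillC-mono-< (bangC a D) lt = s≤s (fillD-mono-< D lt)
fillC-mono-< (parC C P)  lt = +-monoˡ-< (size P) (fillC-mono-< C lt)

Base⇒size-< : {A : Set} {T Q Q' : Proc A} → Base T Q Q' → size Q' < size Q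
Base⇒size-< (B1 C a F F' _) = fillC-mono-< C (s≤s z≤n)
Base⇒size-< (B2 a F P)      = +-monoˡ-< (size (bang a F ∥ P)) (s≤s z≤n)

⟶⇒size-< : {A : Set} {T Q Q' : Proc A} → Q ⟶[ T ] Q' → size Q' < size Q
⟶⇒size-< (R , R' , Q≈R , base , R'≈Q') =
  subst₂ _<_ (size-resp-≈ R'≈Q') (sym (size-resp-≈ Q≈R)) (Base⇒size-< base)

lemma11 : (A : Set) → (A ↣ ℕ) → (P : Proc A) →
          ¬ (Σ (ℕ → Proc A) λ Q → (n : ℕ) → Q n ⟶[ P ] Q (suc n))
lemma11 A _ P (Q , steps) =
  wellFounded⇒¬descendingChain (On.wellFounded size <-wellFounded)
                               (Q , ⟶⇒size-< ∘ steps)
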